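{- $[\![\mathsf{while}~B~\mathsf{do}~C~\mathsf{od}]\!] = (B^{\top} \mathbin{;} [\![C]\!])^{*} \mathbin{;} (\neg B)^{\top}$
   Context: Imperative programs are Kleisli trees $S \to (E,S)\,\mathsf{itree}$. The predicative semantics of a program is $[\![P]\!] = (\lambda (s,s').\, s' \in \mathrm{retvals}(P(s)))$, where $\mathrm{retvals}(P) = \{x \mid \exists tr.\, P \to^{tr} \mathsf{Ret}~x\}$ is the set of values reachable by termination. $\mathsf{while}~B~\mathsf{do}~C~\mathsf{od}$ is defined corecursively: $\mathsf{while}~B~C~s = (\text{if } B(s) \text{ then } \mathsf{Sil}(C~s \mathbin{>\!\!>\!\!=} \mathsf{while}~B~C) \text{ else } \mathsf{Ret}~s)$. For a predicate $P$, $P^{\top}$ denotes the test relation $\lambda (s,s').\, P(s) \land s' = s$; $\mathbin{;}$ is relational composition; $R^{*}$ is reflexive transitive closure. -}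

module Defs where

open import Level using (suc; zero; Lift)
open import Data.Bool using (Bool; true; false; not; if_then_else_)
open import Data.List using (List; []; _∷_)
open import Data.Sum using (_⊎_; inj₁; inj₂)
open import Data.Product using (Σ; ∃; _×_; _,_)
open import Relation.Binary.PropositionalEquality using (_≡_)
open import Relation.Binary.Construct.Closure.ReflexiveTransitive using (Star)
open import Function.Bundles using (_⇔_)

-- Interaction trees  Ret r | Sil t | Vis F  (F a partial function from
-- events to continuations, given by a domain predicate and a continuation).  A tree is the (possibly
-- infinite) unfolding of its root.

data Step (E R X : Set) : Set₁ where
  Ret : R → Step E R X
  Sil : X → Step E R X
  Vis : (dom : E → Set) → (E → X) → Step E R X

record ITree (E R : Set) : Set₁ where
  field
    State : Set
    step  : State → Step E R State
    root  : State

open ITree public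

data Trans {E R : Set} (P : ITree E R) : State P → List E → State P → Set₁ where
  stop : ∀ {x} → Trans P x [] x
  sil  : ∀ {x x' tr y} → step P x ≡ Sil x' → Trans P x' tr y → Trans P x tr y
  vis  : ∀ {x d f e tr y} → step P x ≡ Vis d f → d e → Trans P (f e) tr y →
         Trans P x (e ∷ tr) y

_∈retvals_ : {E R : Set} → R → ITree E R → Set₁
r ∈retvals P = ∃ λ tr → ∃ λ y → Trans P (root P) tr y × (step P y ≡ Ret r)

Kleisli : (E S : Set) → Set₁
Kleisli E S = S → ITree E S

bind : {E A B : Set} → ITree E A → (A → ITree E B) → ITree E B
bind {E} {A} {B} t k = record { State = St ; step = st ; root = inj₁ (root t) }
  where
  St : Set
  St = State t ⊎ Σ A (λ a → State (k a))
  embed : (a : A) → Step E B (State (k a)) → Step E B St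
  embed a (Ret b)   = Ret b
  embed a (Sil x)   = Sil (inj₂ (a , x))
  embed a (Vis d f) = Vis d (λ e → inj₂ (a , f e))
  st : St → Step E B St
  st (inj₁ x) with step t x
  ... | Ret a   = embed a (step (k a) (root (k a)))
  ... | Sil x'  = Sil (inj₁ x')
  ... | Vis d f = Vis d (λ e → inj₁ (f e))
  st (inj₂ (a , y)) = embed a (step (k a) y)

-- while B C s = if B s then Sil (C s >>= while B C) else Ret s
-- (corecursive).  As a pointed coalgebra: states are either "at the loop
-- head with state s" (inj₁ s) or "inside the body C s at node x"
-- (inj₂ (s , x)); when the body returns s', the node behaves as the loop
-- head at s' (exactly as  Ret s' >>= while B C = while B C s').
while : {E S : Set} → (S → Bool) → Kleisli E S → Kleisli E S
while {E} {S} B C s₀ = record { State = St ; step = st ; root = inj₁ s₀ }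
  where
  St : Set
  St = S ⊎ Σ S (λ s → State (C s))
  head : S → Step E S St
  head s = if B s then Sil (inj₂ (s , root (C s))) else Ret s
  st : St → Step E S St
  st (inj₁ s) = head s
  st (inj₂ (s , x)) with step (C s) x
  ... | Ret s'  = head s'
  ... | Sil x'  = Sil (inj₂ (s , x'))
  ... | Vis d f = Vis d (λ e → inj₂ (s , f e))

-- Relations on S (Set₁-valued since ITree lives in Set₁)
Rel₁ : Set → Set₂
Rel₁ S = S → S → Set₁

⟦_⟧ : {E S : Set} → Kleisli E S → Rel₁ S
⟦ P ⟧ s s' = s' ∈retvals (P s)

_ᵀ : {S : Set} → (S → Bool) → Rel₁ S
(B ᵀ) s s' = Lift (suc zero) ((B s ≡ true) × (s' ≡ s))

_⨾_ : {S : Set} → Rel₁ S → Rel₁ S → Rel₁ S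
(R₁ ⨾ R₂) s s'' = ∃ λ s' → R₁ s s' × R₂ s' s''

_* : {S : Set} → Rel₁ S → Rel₁ S
(R *) = Star R

_≐_ : {S : Set} → Rel₁ S → Rel₁ S → Set₁
R₁ ≐ R₂ = ∀ s s' → R₁ s s' ⇔ R₂ s s'

infixr 6 _⨾_
infix 4 _≐_

-- Returning from a node of a tree is the least node/value relation closed under the
-- step rules read backwards.  For ⊆, the relation sending a loop head s to the loop
-- specification at s, and a body node (s , x) to "C s returns some s' from x and the
-- specification holds at s'", is closed, hence contains every return of the loop.
-- For ⊇, induct on the chain of body iterations: a body node (s , x) steps exactly as
-- x does in C s until the body returns s', and then steps as the loop head at s'.
module Submission where

open import Defs
open import Data.Bool using (Bool; true; false; not)
open import Data.Empty using (⊥; ⊥-elim)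
open import Data.List using ([])
open import Data.Product using (∃; _×_; _,_)
open import Data.Sum using (inj₁; inj₂)
open import Function using (_∘_)
open import Function.Bundles using (mk⇔)
open import Level using (lift)
open import Relation.Binary.Construct.Closure.ReflexiveTransitive using (Star; ε; _◅_)
open import Relation.Binary.PropositionalEquality using (_≡_; refl; trans; cong)

Returns : {E R : Set} (P : ITree E R) → State P → R → Set₁
Returns P x r = ∃ λ tr → ∃ λ y → Trans P x tr y × step P y ≡ Ret r

record ReturnsClosed {E R : Set} (P : ITree E R) (I : State P → R → Set₁) : Set₁ where
  field
    ret-step : ∀ {x r} → step P x ≡ Ret r → I x r
    sil-step : ∀ {x x' r} → step P x ≡ Sil x' → I x' r → I x r
    vis-step : ∀ {x d f e r} → step P x ≡ Vis d f → d e → I (f e) r → I x r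

open ReturnsClosed

module _ {E R : Set} {P : ITree E R} where

  Returns-closed : ReturnsClosed P (Returns P)
  Returns-closed = record
    { ret-step = λ e → [] , _ , stop , e
    ; sil-step = λ { e (tr , y , t , r) → tr , y , sil e t , r }
    ; vis-step = λ { e d (tr , y , t , r) → _ , y , vis e d t , r }
    }

  Returns-least : ∀ {I} → ReturnsClosed P I → ∀ {x r} → Returns P x r → I x r
  Returns-least {I} closed (_ , _ , t , e) = go t e
    where
    go : ∀ {x tr y r} → Trans P x tr y → step P y ≡ Ret r → I x r
    go stop        e = closed .ret-step e
    go (sil s t)   e = closed .sil-step s (go t e)
    go (vis s d t) e = closed .vis-step s d (go t e)

  Returns-resp-step : ∀ {x y r} → step P x ≡ step P y → Returns P y r → Returns P x r
  Returns-resp-step e (_ , _ , stop , r)      = [] , _ , stop , trans e r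
  Returns-resp-step e (_ , _ , sil s t , r)   = _ , _ , sil (trans e s) t , r
  Returns-resp-step e (_ , _ , vis s d t , r) = _ , _ , vis (trans e s) d t , r

module WhileLoop {E S : Set} (B : S → Bool) (C : Kleisli E S) (s₀ : S) where

  W : ITree E S
  W = while B C s₀

  LoopSpec : Rel₁ S
  LoopSpec = ((B ᵀ ⨾ ⟦ C ⟧) *) ⨾ ((not ∘ B) ᵀ)

  NodeSpec : State W → S → Set₁
  NodeSpec (inj₁ s)       r = LoopSpec s r
  NodeSpec (inj₂ (s , x)) r = ∃ λ s' → Returns (C s) x s' × LoopSpec s' r

  head-ret : ∀ {s r} → step W (inj₁ s) ≡ Ret r → LoopSpec s r
  head-ret {s} e with B s in b
  head-ret {s} refl | false = s , ε , lift (cong not b , refl)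
  head-ret {s} ()   | true

  head-sil : ∀ {s n r} → step W (inj₁ s) ≡ Sil n → NodeSpec n r → LoopSpec s r
  head-sil {s} e h with B s in b
  head-sil {s} ()   h                              | false
  head-sil {s} refl (s' , body , (m , loop , exit)) | true =
    m , (s , lift (b , refl) , body) ◅ loop , exit

  head-not-vis : ∀ {s d f} → step W (inj₁ s) ≡ Vis d f → ⊥
  head-not-vis {s} e with B s
  head-not-vis {s} () | false
  head-not-vis {s} () | true

  NodeSpec-closed : ReturnsClosed W NodeSpec
  NodeSpec-closed = record { ret-step = at-ret ; sil-step = at-sil ; vis-step = at-vis }
    where
    at-ret : ∀ {n r} → step W n ≡ Ret r → NodeSpec n r
    at-ret {inj₁ s}       e = head-ret e
    at-ret {inj₂ (s , x)} e with step (C s) x in c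
    ... | Ret s' = s' , Returns-closed .ret-step c , head-ret e
    at-ret {inj₂ (s , x)} () | Sil _
    at-ret {inj₂ (s , x)} () | Vis _ _

    at-sil : ∀ {n n' r} → step W n ≡ Sil n' → NodeSpec n' r → NodeSpec n r
    at-sil {inj₁ s}       e h = head-sil e h
    at-sil {inj₂ (s , x)} e h with step (C s) x in c
    ... | Ret s' = s' , Returns-closed .ret-step c , head-sil e h
    at-sil {inj₂ (s , x)} refl (s' , body , spec) | Sil _ =
      s' , Returns-closed .sil-step c body , spec
    at-sil {inj₂ (s , x)} () h | Vis _ _

    at-vis : ∀ {n d f e r} → step W n ≡ Vis d f → d e → NodeSpec (f e) r → NodeSpec n r
    at-vis {inj₁ s}       e d h = ⊥-elim (head-not-vis e)
    at-vis {inj₂ (s , x)} e d h with step (C s) x in c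
    ... | Ret s' = ⊥-elim (head-not-vis e)
    at-vis {inj₂ (s , x)} () d h | Sil _
    at-vis {inj₂ (s , x)} refl d (s' , body , spec) | Vis _ _ =
      s' , Returns-closed .vis-step c d body , spec

  head-exit : ∀ {s} → not (B s) ≡ true → step W (inj₁ s) ≡ Ret s
  head-exit {s} nb with B s
  head-exit {s} nb | false = refl
  head-exit {s} () | true

  head-enter : ∀ {s} → B s ≡ true → step W (inj₁ s) ≡ Sil (inj₂ (s , root (C s)))
  head-enter b rewrite b = refl

  body-step-ret : ∀ {s x s'} → step (C s) x ≡ Ret s' →
                  step W (inj₂ (s , x)) ≡ step W (inj₁ s')
  body-step-ret c rewrite c = refl

  body-step-sil : ∀ {s x x'} → step (C s) x ≡ Sil x' →
                  step W (inj₂ (s , x)) ≡ Sil (inj₂ (s , x'))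
  body-step-sil c rewrite c = refl

  body-step-vis : ∀ {s x d f} → step (C s) x ≡ Vis d f →
                  step W (inj₂ (s , x)) ≡ Vis d (λ e → inj₂ (s , f e))
  body-step-vis c rewrite c = refl

  body-returns : ∀ {s x s' r} → Returns (C s) x s' → Returns W (inj₁ s') r →
                 Returns W (inj₂ (s , x)) r
  body-returns {s} {r = r} = Returns-least closed
    where
    closed : ReturnsClosed (C s) (λ x s' → Returns W (inj₁ s') r → Returns W (inj₂ (s , x)) r)
    closed = record
      { ret-step = λ c → Returns-resp-step (body-step-ret c)
      ; sil-step = λ c k h → Returns-closed .sil-step (body-step-sil c) (k h)
      ; vis-step = λ c d k h → Returns-closed .vis-step (body-step-vis c) d (k h)
      }

  loop-returns : ∀ {s m r} → Star (B ᵀ ⨾ ⟦ C ⟧) s m → ((not ∘ B) ᵀ) m r →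
                 Returns W (inj₁ s) r
  loop-returns ε (lift (nb , refl)) = Returns-closed .ret-step (head-exit nb)
  loop-returns ((_ , lift (b , refl) , body) ◅ loop) exit =
    Returns-closed .sil-step (head-enter b) (body-returns body (loop-returns loop exit))

theorem4p12 : {E S : Set} (B : S → Bool) (C : Kleisli E S) →
    ⟦ while B C ⟧ ≐ ((B ᵀ ⨾ ⟦ C ⟧) *) ⨾ ((not ∘ B) ᵀ)
theorem4p12 B C s r =
  mk⇔ (Returns-least NodeSpec-closed) λ { (_ , loop , exit) → loop-returns loop exit }
  where open WhileLoop B C s
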